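{- For $k\geq m\geq 1$ let $\rho_{m,k}(y)=\sum_{n\geq k+1}op_{n,k}^{m}y^n$, where $op_{n,k}^m$ is the number of ordered preference sets of length $n$ with exactly $k$ flaws and leading term $m$. Then $\rho_{k,k}(y)=y^{k+2}[C(y)]^{k+4}$ for all $k\geq 1$, and $\rho_{m,k}(y)=C(y)\rho_{m+1,k}(y)$ for all $1\leq m\leq k-1$, where $C(y)=\frac{1-\sqrt{1-4y}}{2y}=\sum_{n\geq0}\frac{1}{n+1}\binom{2n}{n}y^n$.
   Context: Parking model: $n$ parking spaces numbered $1,\dots,n$ from left to right; a preference set of length $n$ is a sequence $(a_1,\dots,a_n)$ with $a_i\in[n]$. Cars arrive in order; car $i$ goes to space $a_i$, and if it is occupied, moves to the first unoccupied space to the right; if there is none, the car cannot park. The number of flaws is the number of cars that cannot park. A preference set is ordered if $a_1\leq\cdots\leq a_n$; its leading term is $a_1$. Identities are of formal power series in $y$. -}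

module Defs where

open import Data.Nat using (ℕ; zero; suc; _+_; _*_; _∸_; _≡ᵇ_; _≤ᵇ_; _/_)
open import Data.Nat.Combinatorics using (_C_)
open import Data.Bool using (Bool; true; false; if_then_else_; _∧_)
open import Data.List using (List; []; _∷_; length; filter; map; concatMap; upTo)
open import Data.Bool.ListAction using (any)
open import Data.Maybe using (Maybe; just; nothing)
open import Relation.Nullary.Decidable using (does)
open import Data.Bool.Properties using (T?)
open import Data.Bool using (T)

-- Parking model: spaces 1..n.  A preference set is a list of naturals
-- (entries in [1,n]).  Occupied spaces are kept as a list.

occupied : ℕ → List ℕ → Bool
occupied s occ = any (λ t → t ≡ᵇ s) occ

search : (fuel : ℕ) → ℕ → List ℕ → Maybe ℕ
search zero s occ = nothing
search (suc f) s occ = if occupied s occ then search f (suc s) occ else just s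

spot : (n : ℕ) → (a : ℕ) → List ℕ → Maybe ℕ
spot n a occ = search (suc n ∸ a) a occ

flawsFrom : (n : ℕ) → List ℕ → List ℕ → ℕ
flawsFrom n occ [] = 0
flawsFrom n occ (a ∷ as) with spot n a occ
... | just s  = flawsFrom n (s ∷ occ) as
... | nothing = suc (flawsFrom n occ as)

flaws : ℕ → List ℕ → ℕ
flaws n p = flawsFrom n [] p

seqs : (n len : ℕ) → List (List ℕ)
seqs n zero = [] ∷ []
seqs n (suc len) = concatMap (λ a → map (a ∷_) (seqs n len)) (map suc (upTo n))

prefSets : ℕ → List (List ℕ)
prefSets n = seqs n n

isOrdered : List ℕ → Bool
isOrdered [] = true
isOrdered (a ∷ []) = true
isOrdered (a ∷ b ∷ as) = (a ≤ᵇ b) ∧ isOrdered (b ∷ as)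

leadingIs : ℕ → List ℕ → Bool
leadingIs m [] = false
leadingIs m (a ∷ _) = a ≡ᵇ m

op : (n k m : ℕ) → ℕ
op n k m = length (filter (λ p → T? (isOrdered p ∧ leadingIs m p ∧ (flaws n p ≡ᵇ k))) (prefSets n))

Series : Set
Series = ℕ → ℕ

sumTo : ℕ → (ℕ → ℕ) → ℕ
sumTo zero f = f 0
sumTo (suc n) f = sumTo n f + f (suc n)

_⊛_ : Series → Series → Series
(f ⊛ g) n = sumTo n (λ i → f i * g (n ∸ i))

one : Series
one zero = 1
one (suc _) = 0

_^ˢ_ : Series → ℕ → Series
f ^ˢ zero = one
f ^ˢ suc e = f ⊛ (f ^ˢ e)

shift : ℕ → Series → Series
shift j f n = if j ≤ᵇ n then f (n ∸ j) else 0

Cser : Series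
Cser n = ((2 * n) C n) / suc n

ρ : (m k : ℕ) → Series
ρ m k n = if suc k ≤ᵇ n then op n k m else 0

-- When a weakly increasing preference set is parked car by car, the occupied spaces from the
-- least still admissible preference on always form a single block followed by free spaces up to
-- the end of the lot.  The number of ways to finish therefore depends only on the remaining cars,
-- the block length, the number of free spaces and the flaws still required, and it obeys a
-- two-term recursion: the next car either prefers the least admissible space or it does not.
-- When the free spaces end up exactly filled this count is a difference of binomial coefficients;
-- starting from that boundary, induction identifies the other counts with the ballot numbers
-- [y^j] C(y)^r, which satisfy the same recursion because C = 1 + y C².  For leading term m and
-- k flaws this gives ρ_{m,k}(y) = y^(k+2) C(y)^(2k+4−m), from which both identities follow.

module Submission where

open import Defs
open import Data.Bool using (Bool; true; false; if_then_else_; T; _∧_; _∨_)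
open import Data.Bool.Properties using (T?; T-≡; ∧-assoc; ∧-commutativeMonoid; ∧-zeroʳ; ∨-zeroʳ)
open import Data.Empty using (⊥-elim)
open import Data.List using (List; []; _∷_; _++_; length; filter; map; concatMap; upTo; applyUpTo)
open import Data.Nat.ListAction using (sum)
open import Data.List.Properties using (map-∘; map-upTo)
open import Data.Maybe using (just; nothing)
open import Data.Nat
open import Data.Nat.Combinatorics using (_C_; nCk+nC[k+1]≡[n+1]C[k+1]; k>n⇒nCk≡0; nC1≡n; nCk≡nC[n∸k])
open import Data.Nat.DivMod using (m*n/n≡m)
open import Data.Nat.Properties
open import Data.Nat.Tactic.RingSolver using (solve)
open import Data.Product using (_×_; _,_)
open import Data.Sum using (_⊎_; inj₁; inj₂)
open import Data.Unit using (tt)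
open import Relation.Binary.PropositionalEquality
open import Relation.Nullary using (yes; no)
open import Function.Base using (_∘_)
open import Function.Bundles using (Equivalence)
open import Algebra.Bundles using (CommutativeMonoid)
open import Algebra.Properties.CommutativeSemigroup +-commutativeSemigroup using (interchange)
open import Algebra.Properties.CommutativeSemigroup (CommutativeMonoid.commutativeSemigroup ∧-commutativeMonoid)
  using () renaming (x∙yz≈y∙xz to ∧-swap)

≤ᵇ-true : ∀ {m n} → m ≤ n → (m ≤ᵇ n) ≡ true
≤ᵇ-true m≤n = Equivalence.to T-≡ (≤⇒≤ᵇ m≤n)

≤ᵇ-false : ∀ {m n} → n < m → (m ≤ᵇ n) ≡ false
≤ᵇ-false {m} {n} n<m with m ≤ᵇ n in eq
... | false = refl
... | true  = ⊥-elim (<⇒≱ n<m (≤ᵇ⇒≤ m n (subst T (sym eq) tt)))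

≡ᵇ-false : ∀ {m n} → m ≢ n → (m ≡ᵇ n) ≡ false
≡ᵇ-false {m} {n} m≢n with m ≡ᵇ n in eq
... | false = refl
... | true  = ⊥-elim (m≢n (≡ᵇ⇒≡ m n (subst T (sym eq) tt)))

≤ᵇ-suc-suc : ∀ m n → (suc m ≤ᵇ suc n) ≡ (m ≤ᵇ n)
≤ᵇ-suc-suc zero    n = refl
≤ᵇ-suc-suc (suc m) n = refl

≤ᵇ-suc-split : ∀ x p → ((suc p ≡ᵇ x) ∨ (x ≤ᵇ p)) ≡ (x ≤ᵇ suc p)
≤ᵇ-suc-split x p with x ≤? p
... | yes x≤p = trans (cong ((suc p ≡ᵇ x) ∨_) (≤ᵇ-true x≤p)) (trans (∨-zeroʳ _) (sym (≤ᵇ-true (m≤n⇒m≤1+n x≤p))))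
... | no  x≰p with x ≟ suc p
...   | yes refl =
  trans (cong (_∨ (suc p ≤ᵇ p)) (Equivalence.to T-≡ (≡⇒≡ᵇ (suc p) (suc p) refl))) (sym (≤ᵇ-true (≤-refl {suc p})))
...   | no  x≢1+p = trans (cong₂ _∨_ (≡ᵇ-false (x≢1+p ∘ sym)) (≤ᵇ-false (≰⇒> x≰p))) (sym (≤ᵇ-false 1+p<x))
  where 1+p<x = ≤∧≢⇒< (≰⇒> x≰p) (x≢1+p ∘ sym)

-- Binomial coefficients and ballot numbers

binom : ℕ → ℕ → ℕ
binom n       zero    = 1
binom zero    (suc k) = 0
binom (suc n) (suc k) = binom n k + binom n (suc k)

binom≡C : ∀ n k → binom n k ≡ n C k
binom≡C n       zero    = refl
binom≡C zero    (suc k) = sym (k>n⇒nCk≡0 (s≤s (z≤n {k})))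
binom≡C (suc n) (suc k) =
  trans (cong₂ _+_ (binom≡C n k) (binom≡C n (suc k))) (nCk+nC[k+1]≡[n+1]C[k+1] n k)

binom-above : ∀ {n k} → n < k → binom n k ≡ 0
binom-above {n} {k} n<k = trans (binom≡C n k) (k>n⇒nCk≡0 n<k)

binom-sym : ∀ a b → binom (a + b) a ≡ binom (a + b) b
binom-sym a b = begin
  binom (a + b) a           ≡⟨ binom≡C (a + b) a ⟩
  (a + b) C a               ≡⟨ nCk≡nC[n∸k] (m≤m+n a b) ⟩
  (a + b) C (a + b ∸ a)     ≡⟨ cong ((a + b) C_) (m+n∸m≡n a b) ⟩
  (a + b) C b               ≡⟨ binom≡C (a + b) b ⟨
  binom (a + b) b           ∎
  where open ≡-Reasoning

binom-absorption : ∀ m k → suc k * binom (suc m) (suc k) ≡ suc m * binom m k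
binom-absorption m       zero    =
  trans (*-identityˡ _) (trans (binom≡C (suc m) 1) (trans (nC1≡n (suc m)) (sym (*-identityʳ _))))
binom-absorption zero    (suc k) = *-zeroʳ (suc (suc k))
binom-absorption (suc m) (suc k) = begin
  (2 + k) * (binom (suc m) (suc k) + binom (suc m) (2 + k))
    ≡⟨ *-distribˡ-+ (2 + k) (binom (suc m) (suc k)) _ ⟩
  (1 + (1 + k)) * binom (suc m) (suc k) + (2 + k) * binom (suc m) (2 + k)
    ≡⟨ cong₂ _+_ (cong (binom (suc m) (suc k) +_) (binom-absorption m k)) (binom-absorption m (suc k)) ⟩
  (binom (suc m) (suc k) + suc m * binom m k) + suc m * binom m (suc k)
    ≡⟨ +-assoc (binom (suc m) (suc k)) _ _ ⟩
  binom (suc m) (suc k) + (suc m * binom m k + suc m * binom m (suc k))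
    ≡⟨ cong (binom (suc m) (suc k) +_) (*-distribˡ-+ (suc m) (binom m k) _) ⟨
  binom (suc m) (suc k) + suc m * binom (suc m) (suc k)
    ∎
  where open ≡-Reasoning

-- N choose (i ∸ d), but 0 when i < d.
shiftedBinom : ℕ → ℕ → ℕ → ℕ
shiftedBinom zero    N i       = binom N i
shiftedBinom (suc d) N zero    = 0
shiftedBinom (suc d) N (suc i) = shiftedBinom d N i

shiftedBinom-pascal : ∀ d N i → shiftedBinom d (suc N) i ≡ shiftedBinom (suc d) N i + shiftedBinom d N i
shiftedBinom-pascal zero    N zero    = refl
shiftedBinom-pascal zero    N (suc i) = refl
shiftedBinom-pascal (suc d) N zero    = refl
shiftedBinom-pascal (suc d) N (suc i) = shiftedBinom-pascal d N i

-- ballot j r is the coefficient of y^j in C(y)^r; the recursion is C^(r+1) = C^r + y C^(r+2), from C = 1 + y C².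
ballot : ℕ → ℕ → ℕ
ballot zero    r       = 1
ballot (suc j) zero    = 0
ballot (suc j) (suc r) = ballot (suc j) r + ballot j (suc (suc r))

ballot-formula : ∀ j s {N} → j + j + s ≡ N → ballot j (suc s) + shiftedBinom 1 N j ≡ binom N j
ballot-formula zero    s       refl = refl
ballot-formula (suc j) zero refl = begin
  ballot j 2 + binom (suc M) j                  ≡⟨ cong (ballot j 2 +_) (shiftedBinom-pascal 0 M j) ⟩
  ballot j 2 + (shiftedBinom 1 M j + binom M j) ≡⟨ +-assoc (ballot j 2) _ _ ⟨
  ballot j 2 + shiftedBinom 1 M j + binom M j   ≡⟨ cong (_+ binom M j) (ballot-formula j 1 {j + suc j + 0} (solve (j ∷ []))) ⟩
  binom M j + binom M j                         ≡⟨ cong (binom M j +_) middle-sym ⟩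
  binom M j + binom M (suc j)                   ∎
  where
    open ≡-Reasoning
    M = j + suc j + 0
    middle-sym : binom M j ≡ binom M (suc j)
    middle-sym = subst (λ K → binom K j ≡ binom K (suc j)) (sym (+-identityʳ _)) (binom-sym j (suc j))
ballot-formula (suc j) (suc s) refl = begin
  (X + Y) + binom (suc M) j                  ≡⟨ cong ((X + Y) +_) (shiftedBinom-pascal 0 M j) ⟩
  (X + Y) + (shiftedBinom 1 M j + binom M j) ≡⟨ cong ((X + Y) +_) (+-comm (shiftedBinom 1 M j) _) ⟩
  (X + Y) + (binom M j + shiftedBinom 1 M j) ≡⟨ interchange X Y _ _ ⟩
  (X + binom M j) + (Y + shiftedBinom 1 M j) ≡⟨ cong₂ _+_ (ballot-formula (suc j) s {j + suc j + suc s} (solve (j ∷ s ∷ [])))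
                                                          (ballot-formula j (2 + s) {j + suc j + suc s} (solve (j ∷ s ∷ []))) ⟩
  binom M (suc j) + binom M j                ≡⟨ +-comm (binom M (suc j)) _ ⟩
  binom M j + binom M (suc j)                ∎
  where
    open ≡-Reasoning
    M = j + suc j + suc s
    X = ballot (suc j) (suc s)
    Y = ballot j (3 + s)

catalan-formula : ∀ n → suc n * ballot n 1 ≡ binom (n + n) n
catalan-formula zero    = refl
catalan-formula (suc n) = +-cancelʳ-≡ (suc n * binom N (suc n)) _ _ (begin
  (2 + n) * B + suc n * binom N (suc n) ≡⟨ cong ((2 + n) * B +_) lower≡upper ⟨
  (2 + n) * B + (2 + n) * binom N n     ≡⟨ *-distribˡ-+ (2 + n) B _ ⟨
  (2 + n) * (B + binom N n)             ≡⟨ cong ((2 + n) *_) (ballot-formula (suc n) 0 {N} (+-identityʳ _)) ⟩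
  (2 + n) * binom N (suc n)             ∎)
  where
    open ≡-Reasoning
    M = suc (n + n)
    N = suc n + suc n
    B = ballot (suc n) 1
    N≡1+M : suc n + suc n ≡ suc (suc (n + n))
    N≡1+M = solve (n ∷ [])
    n+[2+n]≡1+M : n + (2 + n) ≡ suc (suc (n + n))
    n+[2+n]≡1+M = solve (n ∷ [])
    lower≡upper : (2 + n) * binom N n ≡ suc n * binom N (suc n)
    lower≡upper = begin
      (2 + n) * binom N n                   ≡⟨ cong (λ K → (2 + n) * binom K n) (trans N≡1+M (sym n+[2+n]≡1+M)) ⟩
      (2 + n) * binom (n + (2 + n)) n       ≡⟨ cong ((2 + n) *_) (binom-sym n (2 + n)) ⟩
      (2 + n) * binom (n + (2 + n)) (2 + n) ≡⟨ cong (λ K → (2 + n) * binom K (2 + n)) n+[2+n]≡1+M ⟩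
      (2 + n) * binom (suc M) (2 + n)       ≡⟨ binom-absorption M (suc n) ⟩
      suc M * binom M (suc n)               ≡⟨ cong (suc M *_) (binom-sym (suc n) n) ⟩
      suc M * binom M n                     ≡⟨ binom-absorption M n ⟨
      suc n * binom (suc M) (suc n)         ≡⟨ cong (λ K → suc n * binom K (suc n)) N≡1+M ⟨
      suc n * binom N (suc n)               ∎

catalan≡ballot : ∀ n → Cser n ≡ ballot n 1
catalan≡ballot n = begin
  ((2 * n) C n) / suc n         ≡⟨ cong (λ K → (K C n) / suc n) (solve (n ∷ [])) ⟩
  ((n + n) C n) / suc n         ≡⟨ cong (_/ suc n) (binom≡C (n + n) n) ⟨
  binom (n + n) n / suc n       ≡⟨ cong (_/ suc n) (catalan-formula n) ⟨
  (suc n * ballot n 1) / suc n  ≡⟨ cong (_/ suc n) (*-comm (suc n) (ballot n 1)) ⟩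
  (ballot n 1 * suc n) / suc n  ≡⟨ m*n/n≡m (ballot n 1) (suc n) ⟩
  ballot n 1                    ∎
  where open ≡-Reasoning

-- Formal power series

sumTo-cong : ∀ n {f g : ℕ → ℕ} → (∀ i → i ≤ n → f i ≡ g i) → sumTo n f ≡ sumTo n g
sumTo-cong zero    f≗g = f≗g 0 z≤n
sumTo-cong (suc n) f≗g = cong₂ _+_ (sumTo-cong n (λ i i≤n → f≗g i (m≤n⇒m≤1+n i≤n))) (f≗g (suc n) ≤-refl)

sumTo-vanish : ∀ n {f : ℕ → ℕ} → (∀ i → i ≤ n → f i ≡ 0) → sumTo n f ≡ 0
sumTo-vanish zero    f≗0 = f≗0 0 z≤n
sumTo-vanish (suc n) f≗0 = cong₂ _+_ (sumTo-vanish n (λ i i≤n → f≗0 i (m≤n⇒m≤1+n i≤n))) (f≗0 (suc n) ≤-refl)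

sumTo-distrib-+ : ∀ n (f g : ℕ → ℕ) → sumTo n (λ i → f i + g i) ≡ sumTo n f + sumTo n g
sumTo-distrib-+ zero    f g = refl
sumTo-distrib-+ (suc n) f g =
  trans (cong (_+ (f (suc n) + g (suc n))) (sumTo-distrib-+ n f g)) (interchange (sumTo n f) _ _ _)

sumTo-suc-head : ∀ n (f : ℕ → ℕ) → sumTo (suc n) f ≡ f 0 + sumTo n (λ i → f (suc i))
sumTo-suc-head zero    f = refl
sumTo-suc-head (suc n) f = trans (cong (_+ f (2 + n)) (sumTo-suc-head n f)) (+-assoc (f 0) _ _)

sumTo-trailing-zeros : ∀ m d {f : ℕ → ℕ} → (∀ i → m < i → i ≤ m + d → f i ≡ 0) → sumTo (m + d) f ≡ sumTo m f
sumTo-trailing-zeros m zero    {f} _   = cong (λ K → sumTo K f) (+-identityʳ m)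
sumTo-trailing-zeros m (suc d) {f} f≗0 = begin
  sumTo (m + suc d) f               ≡⟨ cong (λ K → sumTo K f) (+-suc m d) ⟩
  sumTo (m + d) f + f (suc (m + d)) ≡⟨ cong₂ _+_ (sumTo-trailing-zeros m d (λ i m<i i≤m+d → f≗0 i m<i (≤-trans i≤m+d m+d≤m+1+d)))
                                                 (f≗0 (suc (m + d)) (s≤s (m≤m+n m d)) (≤-reflexive (sym (+-suc m d)))) ⟩
  sumTo m f + 0                     ≡⟨ +-identityʳ _ ⟩
  sumTo m f                         ∎
  where
    open ≡-Reasoning
    m+d≤m+1+d : m + d ≤ m + suc d
    m+d≤m+1+d = +-monoʳ-≤ m (n≤1+n d)

_+ˢ_ : Series → Series → Series
(f +ˢ g) n = f n + g n

yTimes : Series → Series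
yTimes f zero    = 0
yTimes f (suc n) = f n

⊛-congˡ : ∀ {f f′} g n → (∀ i → f i ≡ f′ i) → (f ⊛ g) n ≡ (f′ ⊛ g) n
⊛-congˡ g n f≗f′ = sumTo-cong n (λ i _ → cong (_* g (n ∸ i)) (f≗f′ i))

⊛-distribʳ-+ˢ : ∀ f g h n → ((f +ˢ g) ⊛ h) n ≡ (f ⊛ h) n + (g ⊛ h) n
⊛-distribʳ-+ˢ f g h n =
  trans (sumTo-cong n (λ i _ → *-distribʳ-+ (h (n ∸ i)) (f i) (g i)))
        (sumTo-distrib-+ n (λ i → f i * h (n ∸ i)) (λ i → g i * h (n ∸ i)))

one-⊛ : ∀ g n → (one ⊛ g) n ≡ g n
one-⊛ g zero    = +-identityʳ (g 0)
one-⊛ g (suc n) = begin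
  (one ⊛ g) (suc n)                                         ≡⟨ sumTo-suc-head n (λ i → one i * g (suc n ∸ i)) ⟩
  1 * g (suc n) + sumTo n (λ i → one (suc i) * g (n ∸ i))   ≡⟨ cong₂ _+_ (*-identityˡ _) (sumTo-vanish n (λ _ _ → refl)) ⟩
  g (suc n) + 0                                             ≡⟨ +-identityʳ _ ⟩
  g (suc n)                                                 ∎
  where open ≡-Reasoning

yTimes-⊛ : ∀ f g n → (yTimes f ⊛ g) (suc n) ≡ (f ⊛ g) n
yTimes-⊛ f g n = sumTo-suc-head n (λ i → yTimes f i * g (suc n ∸ i))

shift-below : ∀ d g {n} → n < d → shift d g n ≡ 0
shift-below d g {n} n<d = cong (if_then g (n ∸ d) else 0) (≤ᵇ-false n<d)

shift-intro : ∀ d {f} g → (∀ n → n < d → f n ≡ 0) → (∀ j → f (j + d) ≡ g j) → ∀ n → f n ≡ shift d g n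
shift-intro d {f} g below above n with d ≤? n
... | no  d≰n = trans (below n (≰⇒> d≰n)) (sym (shift-below d g (≰⇒> d≰n)))
... | yes d≤n = begin
  f n                                         ≡⟨ cong f (m∸n+n≡m d≤n) ⟨
  f (n ∸ d + d)                               ≡⟨ above (n ∸ d) ⟩
  g (n ∸ d)                                   ≡⟨ cong (if_then g (n ∸ d) else 0) (≤ᵇ-true d≤n) ⟨
  shift d g n                                 ∎
  where open ≡-Reasoning

shift-+ : ∀ d g n → shift d g (n + d) ≡ g n
shift-+ d g n = trans (cong (if_then g (n + d ∸ d) else 0) (≤ᵇ-true (m≤n+m d n))) (cong g (m+n∸n≡m n d))

⊛-shift : ∀ f g d n → (f ⊛ shift d g) n ≡ shift d (f ⊛ g) n
⊛-shift f g d = shift-intro d (f ⊛ g) vanishes coefficient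
  where
    vanishes : ∀ n → n < d → (f ⊛ shift d g) n ≡ 0
    vanishes n n<d = sumTo-vanish n (λ i _ →
      trans (cong (f i *_) (shift-below d g (≤-<-trans (m∸n≤m n i) n<d))) (*-zeroʳ (f i)))
    beyond : ∀ m i → m < i → i ≤ m + d → f i * shift d g (m + d ∸ i) ≡ 0
    beyond m i m<i i≤m+d = trans (cong (f i *_) (shift-below d g m+d∸i<d)) (*-zeroʳ (f i))
      where m+d∸i<d = <-≤-trans (∸-monoʳ-< m<i i≤m+d) (≤-reflexive (m+n∸m≡n m d))
    unshift : ∀ m i → i ≤ m → f i * shift d g (m + d ∸ i) ≡ f i * g (m ∸ i)
    unshift m i i≤m = cong (f i *_) (trans (cong (shift d g) (+-∸-comm d i≤m)) (shift-+ d g (m ∸ i)))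
    coefficient : ∀ m → (f ⊛ shift d g) (m + d) ≡ (f ⊛ g) m
    coefficient m = trans (sumTo-trailing-zeros m d (beyond m)) (sumTo-cong m (unshift m))

ballotSeries : ℕ → Series
ballotSeries r j = ballot j r

ballotSeries-zero : ∀ j → ballotSeries 0 j ≡ one j
ballotSeries-zero zero    = refl
ballotSeries-zero (suc j) = refl

ballotSeries-suc : ∀ r j → ballotSeries (suc r) j ≡ (ballotSeries r +ˢ yTimes (ballotSeries (2 + r))) j
ballotSeries-suc r zero    = refl
ballotSeries-suc r (suc j) = refl

ballotSeries-⊛ : ∀ j a b → (ballotSeries a ⊛ ballotSeries b) j ≡ ballot j (a + b)
ballotSeries-⊛ j       zero    b = trans (⊛-congˡ (ballotSeries b) j ballotSeries-zero) (one-⊛ (ballotSeries b) j)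
ballotSeries-⊛ zero    (suc a) b = refl
ballotSeries-⊛ (suc j) (suc a) b = begin
  (ballotSeries (suc a) ⊛ Bb) (suc j)                      ≡⟨ ⊛-congˡ Bb (suc j) (ballotSeries-suc a) ⟩
  ((ballotSeries a +ˢ yTimes (ballotSeries (2 + a))) ⊛ Bb) (suc j)
    ≡⟨ ⊛-distribʳ-+ˢ (ballotSeries a) (yTimes (ballotSeries (2 + a))) Bb (suc j) ⟩
  (ballotSeries a ⊛ Bb) (suc j) + (yTimes (ballotSeries (2 + a)) ⊛ Bb) (suc j)
    ≡⟨ cong₂ _+_ (ballotSeries-⊛ (suc j) a b) (yTimes-⊛ (ballotSeries (2 + a)) Bb j) ⟩
  ballot (suc j) (a + b) + (ballotSeries (2 + a) ⊛ Bb) j   ≡⟨ cong (ballot (suc j) (a + b) +_) (ballotSeries-⊛ j (2 + a) b) ⟩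
  ballot (suc j) (suc a + b)                               ∎
  where
    open ≡-Reasoning
    Bb = ballotSeries b

catalan-power : ∀ r j → (Cser ^ˢ r) j ≡ ballot j r
catalan-power zero    zero    = refl
catalan-power zero    (suc j) = refl
catalan-power (suc r) j =
  trans (sumTo-cong j (λ i _ → cong₂ _*_ (catalan≡ballot i) (catalan-power r (j ∸ i)))) (ballotSeries-⊛ j 1 r)

-- Counting preference sets

sumBelow : ℕ → (ℕ → ℕ) → ℕ
sumBelow n g = sum (applyUpTo g n)

sumBelow-cong : ∀ n {g h : ℕ → ℕ} → (∀ i → g i ≡ h i) → sumBelow n g ≡ sumBelow n h
sumBelow-cong zero    g≗h = refl
sumBelow-cong (suc n) g≗h = cong₂ _+_ (g≗h 0) (sumBelow-cong n (λ i → g≗h (suc i)))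

sumBelow-zeros : ∀ n → sumBelow n (λ _ → 0) ≡ 0
sumBelow-zeros zero    = refl
sumBelow-zeros (suc n) = sumBelow-zeros n

sumBelow-indicator : ∀ n c (h : ℕ → ℕ) → c < n → sumBelow n (λ i → if i ≡ᵇ c then h i else 0) ≡ h c
sumBelow-indicator (suc n) zero    h _         = trans (cong (h 0 +_) (sumBelow-zeros n)) (+-identityʳ (h 0))
sumBelow-indicator (suc n) (suc c) h (s≤s c<n) = sumBelow-indicator n c (λ i → h (suc i)) c<n

sumRange : ℕ → ℕ → (ℕ → ℕ) → ℕ
sumRange c n h = sumBelow n (λ i → if c ≤ᵇ i then h i else 0)

sumRange-suc : ∀ c n h → sumRange (suc c) (suc n) h ≡ sumRange c n (λ i → h (suc i))
sumRange-suc zero    n h = refl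
sumRange-suc (suc c) n h = refl

sumRange-empty : ∀ c n h → n ≤ c → sumRange c n h ≡ 0
sumRange-empty c       zero    h _         = refl
sumRange-empty (suc c) (suc n) h (s≤s n≤c) = trans (sumRange-suc c n h) (sumRange-empty c n (λ i → h (suc i)) n≤c)

sumRange-head : ∀ c n h → c < n → sumRange c n h ≡ h c + sumRange (suc c) n h
sumRange-head zero    (suc n) h _         = refl
sumRange-head (suc c) (suc n) h (s≤s c<n) = begin
  sumRange (suc c) (suc n) h                            ≡⟨ sumRange-suc c n h ⟩
  sumRange c n (λ i → h (suc i))                        ≡⟨ sumRange-head c n (λ i → h (suc i)) c<n ⟩
  h (suc c) + sumRange (suc c) n (λ i → h (suc i))      ≡⟨ cong (h (suc c) +_) (sumRange-suc (suc c) n h) ⟨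
  h (suc c) + sumRange (suc (suc c)) (suc n) h          ∎
  where open ≡-Reasoning

countᵇ : {A : Set} → (A → Bool) → List A → ℕ
countᵇ f []       = 0
countᵇ f (x ∷ xs) = if f x then suc (countᵇ f xs) else countᵇ f xs

module _ {A : Set} where

  length-filter-T? : ∀ (f : A → Bool) xs → length (filter (λ x → T? (f x)) xs) ≡ countᵇ f xs
  length-filter-T? f []       = refl
  length-filter-T? f (x ∷ xs) with f x
  ... | true  = cong suc (length-filter-T? f xs)
  ... | false = length-filter-T? f xs

  countᵇ-cong : ∀ {f g : A → Bool} xs → (∀ x → f x ≡ g x) → countᵇ f xs ≡ countᵇ g xs
  countᵇ-cong         []       f≗g = refl
  countᵇ-cong {f} {g} (x ∷ xs) f≗g rewrite f≗g x = cong (λ r → if g x then suc r else r) (countᵇ-cong xs f≗g)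

  countᵇ-guard : ∀ c (f : A → Bool) xs → countᵇ (λ x → c ∧ f x) xs ≡ (if c then countᵇ f xs else 0)
  countᵇ-guard true  f xs       = refl
  countᵇ-guard false f []       = refl
  countᵇ-guard false f (x ∷ xs) = countᵇ-guard false f xs

  countᵇ-++ : ∀ (f : A → Bool) xs ys → countᵇ f (xs ++ ys) ≡ countᵇ f xs + countᵇ f ys
  countᵇ-++ f []       ys = refl
  countᵇ-++ f (x ∷ xs) ys with f x
  ... | true  = cong suc (countᵇ-++ f xs ys)
  ... | false = countᵇ-++ f xs ys

  countᵇ-map : ∀ {B : Set} (f : A → Bool) (g : B → A) xs → countᵇ f (map g xs) ≡ countᵇ (λ x → f (g x)) xs
  countᵇ-map f g []       = refl
  countᵇ-map f g (x ∷ xs) with f (g x)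
  ... | true  = cong suc (countᵇ-map f g xs)
  ... | false = countᵇ-map f g xs

  countᵇ-concatMap : ∀ {B : Set} (f : A → Bool) (g : B → List A) xs →
                     countᵇ f (concatMap g xs) ≡ sum (map (λ x → countᵇ f (g x)) xs)
  countᵇ-concatMap f g []       = refl
  countᵇ-concatMap f g (x ∷ xs) = trans (countᵇ-++ f (g x) (concatMap g xs)) (cong (countᵇ f (g x) +_) (countᵇ-concatMap f g xs))

countᵇ-seqs : ∀ (f : List ℕ → Bool) n L →
              countᵇ f (seqs n (suc L)) ≡ sumBelow n (λ i → countᵇ (λ t → f (suc i ∷ t)) (seqs n L))
countᵇ-seqs f n L = begin
  countᵇ f (concatMap (λ a → map (a ∷_) (seqs n L)) (map suc (upTo n)))
    ≡⟨ countᵇ-concatMap f (λ a → map (a ∷_) (seqs n L)) (map suc (upTo n)) ⟩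
  sum (map count-from (map suc (upTo n)))       ≡⟨ cong sum (map-∘ (upTo n)) ⟨
  sum (map (λ i → count-from (suc i)) (upTo n)) ≡⟨ cong sum (map-upTo (λ i → count-from (suc i)) n) ⟩
  sumBelow n (λ i → count-from (suc i))         ≡⟨ sumBelow-cong n (λ i → countᵇ-map f (suc i ∷_) (seqs n L)) ⟩
  sumBelow n (λ i → countᵇ (λ t → f (suc i ∷ t)) (seqs n L)) ∎
  where
    open ≡-Reasoning
    count-from : ℕ → ℕ
    count-from a = countᵇ f (map (a ∷_) (seqs n L))

-- Parking behind a block of occupied spaces

record OccupiedBlock (occ : List ℕ) (b p : ℕ) : Set where
  constructor occupiedBlock
  field occupied-from : ∀ x → b ≤ x → occupied x occ ≡ (x ≤ᵇ p)
open OccupiedBlock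

occupiedBlock-[] : ∀ p → OccupiedBlock [] (suc p) p
occupiedBlock-[] p = occupiedBlock (λ x p<x → sym (≤ᵇ-false p<x))

occupiedBlock-mono : ∀ {occ b b′ p} → b ≤ b′ → OccupiedBlock occ b p → OccupiedBlock occ b′ p
occupiedBlock-mono b≤b′ block = occupiedBlock (λ x b′≤x → occupied-from block x (≤-trans b≤b′ b′≤x))

occupiedBlock-park : ∀ {occ b p} → OccupiedBlock occ b p → OccupiedBlock (suc p ∷ occ) b (suc p)
occupiedBlock-park {p = p} block =
  occupiedBlock (λ x b≤x → trans (cong ((suc p ≡ᵇ x) ∨_) (occupied-from block x b≤x)) (≤ᵇ-suc-split x p))

occupiedBlock-skip : ∀ {occ p} → OccupiedBlock occ (suc p) p → OccupiedBlock occ (2 + p) (suc p)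
occupiedBlock-skip block = occupiedBlock λ x 2+p≤x →
  let 1+p<x = ≤-trans (n≤1+n _) 2+p≤x in
  trans (occupied-from block x 1+p<x) (trans (≤ᵇ-false 1+p<x) (sym (≤ᵇ-false 2+p≤x)))

search-across-block : ∀ {occ b p} → OccupiedBlock occ b p →
                      ∀ d f x → b ≤ x → x + d ≡ suc p → search (d + f) x occ ≡ search f (suc p) occ
search-across-block {occ} block zero    f x b≤x x+0≡1+p =
  cong (λ y → search f y occ) (trans (sym (+-identityʳ x)) x+0≡1+p)
search-across-block {occ} {b} {p} block (suc d) f x b≤x x+1+d≡1+p = begin
  (if occupied x occ then search (d + f) (suc x) occ else just x)
    ≡⟨ cong (if_then search (d + f) (suc x) occ else just x) x-occupied ⟩
  search (d + f) (suc x) occ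
    ≡⟨ search-across-block block d f (suc x) (m≤n⇒m≤1+n b≤x) (trans (sym (+-suc x d)) x+1+d≡1+p) ⟩
  search f (suc p) occ
    ∎
  where
    open ≡-Reasoning
    x≤p : x ≤ p
    x≤p = ≤-pred (≤-trans (s≤s (m≤m+n x d)) (≤-reflexive (trans (sym (+-suc x d)) x+1+d≡1+p)))
    x-occupied : occupied x occ ≡ true
    x-occupied = trans (occupied-from block x b≤x) (≤ᵇ-true x≤p)

spot-block : ∀ {occ b p} n e s → OccupiedBlock occ b p → e + b ≡ suc p → s + p ≡ n → spot n b occ ≡ search s (suc p) occ
spot-block {occ} {b} {p} n e s block e+b≡1+p s+p≡n =
  trans (cong (λ f → search f b occ) fuel) (search-across-block block e s b ≤-refl (trans (+-comm b e) e+b≡1+p))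
  where
    open ≡-Reasoning
    fuel : suc n ∸ b ≡ e + s
    fuel = begin
      suc n ∸ b           ≡⟨ cong (λ m → suc m ∸ b) s+p≡n ⟨
      suc (s + p) ∸ b     ≡⟨ cong (_∸ b) (+-suc s p) ⟨
      s + suc p ∸ b       ≡⟨ cong (λ m → s + m ∸ b) e+b≡1+p ⟨
      s + (e + b) ∸ b     ≡⟨ cong (_∸ b) (+-assoc s e b) ⟨
      s + e + b ∸ b       ≡⟨ m+n∸n≡m (s + e) b ⟩
      s + e               ≡⟨ +-comm s e ⟩
      e + s               ∎

spot-park : ∀ {occ b p} n e s → OccupiedBlock occ b p → e + b ≡ suc p → suc s + p ≡ n → spot n b occ ≡ just (suc p)
spot-park {occ} {b} {p} n e s block e+b≡1+p s+p≡n = trans (spot-block n e (suc s) block e+b≡1+p s+p≡n) free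
  where
    free : search (suc s) (suc p) occ ≡ just (suc p)
    free = cong (if_then search s (2 + p) occ else just (suc p))
                (trans (occupied-from block (suc p) (≤-trans (m≤n+m b e) (≤-reflexive e+b≡1+p))) (≤ᵇ-false (≤-refl {suc p})))

flawsFrom-park : ∀ n occ a t {q} → spot n a occ ≡ just q → flawsFrom n occ (a ∷ t) ≡ flawsFrom n (q ∷ occ) t
flawsFrom-park n occ a t eq with spot n a occ
flawsFrom-park n occ a t refl | .(just _) = refl

flawsFrom-fail : ∀ n occ a t → spot n a occ ≡ nothing → flawsFrom n occ (a ∷ t) ≡ suc (flawsFrom n occ t)
flawsFrom-fail n occ a t eq with spot n a occ
flawsFrom-fail n occ a t refl | .nothing = refl

orderedFrom : ℕ → List ℕ → Bool
orderedFrom b []       = true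
orderedFrom b (a ∷ as) = (b ≤ᵇ a) ∧ orderedFrom a as

isOrdered-∷ : ∀ a t → isOrdered (a ∷ t) ≡ orderedFrom a t
isOrdered-∷ a []      = refl
isOrdered-∷ a (b ∷ t) = cong ((a ≤ᵇ b) ∧_) (isOrdered-∷ b t)

continuations : (n L b : ℕ) → List ℕ → ℕ → ℕ
continuations n L b occ k = countᵇ (λ t → orderedFrom b t ∧ (flawsFrom n occ t ≡ᵇ k)) (seqs n L)

continuationsWithHead : (n L : ℕ) → List ℕ → ℕ → ℕ → ℕ
continuationsWithHead n L occ k a = countᵇ (λ t → orderedFrom a t ∧ (flawsFrom n occ (a ∷ t) ≡ᵇ k)) (seqs n L)

continuations-by-head : ∀ n L c occ k →
                        continuations n (suc L) (suc c) occ k ≡ sumRange c n (λ i → continuationsWithHead n L occ k (suc i))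
continuations-by-head n L c occ k = trans (countᵇ-seqs _ n L) (sumBelow-cong n by-guard)
  where
    F : ℕ → List ℕ → Bool
    F a t = orderedFrom a t ∧ (flawsFrom n occ (a ∷ t) ≡ᵇ k)
    by-guard : ∀ i → countᵇ (λ t → ((suc c ≤ᵇ suc i) ∧ orderedFrom (suc i) t) ∧ (flawsFrom n occ (suc i ∷ t) ≡ᵇ k)) (seqs n L)
                   ≡ (if c ≤ᵇ i then continuationsWithHead n L occ k (suc i) else 0)
    by-guard i = begin
      _ ≡⟨ countᵇ-cong (seqs n L) (λ t → ∧-assoc (suc c ≤ᵇ suc i) (orderedFrom (suc i) t) _) ⟩
      countᵇ (λ t → (suc c ≤ᵇ suc i) ∧ F (suc i) t) (seqs n L)   ≡⟨ countᵇ-guard (suc c ≤ᵇ suc i) (F (suc i)) (seqs n L) ⟩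
      (if suc c ≤ᵇ suc i then continuationsWithHead n L occ k (suc i) else 0)
        ≡⟨ cong (if_then continuationsWithHead n L occ k (suc i) else 0) (≤ᵇ-suc-suc c i) ⟩
      (if c ≤ᵇ i then continuationsWithHead n L occ k (suc i) else 0) ∎
      where open ≡-Reasoning

continuations-step : ∀ n L c occ k → c < n →
                     continuations n (suc L) (suc c) occ k
                       ≡ continuationsWithHead n L occ k (suc c) + continuations n (suc L) (2 + c) occ k
continuations-step n L c occ k c<n = begin
  continuations n (suc L) (suc c) occ k                                 ≡⟨ continuations-by-head n L c occ k ⟩
  sumRange c n H                                                        ≡⟨ sumRange-head c n H c<n ⟩
  H c + sumRange (suc c) n H                                            ≡⟨ cong (H c +_) (continuations-by-head n L (suc c) occ k) ⟨
  continuationsWithHead n L occ k (suc c) + continuations n (suc L) (2 + c) occ k ∎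
  where
    open ≡-Reasoning
    H : ℕ → ℕ
    H i = continuationsWithHead n L occ k (suc i)

continuations-beyond : ∀ n L c occ k → n ≤ c → continuations n (suc L) (suc c) occ k ≡ 0
continuations-beyond n L c occ k n≤c =
  trans (continuations-by-head n L c occ k) (sumRange-empty c n _ n≤c)

continuationsWithHead-park : ∀ n L occ k a {q} → spot n a occ ≡ just q →
                             continuationsWithHead n L occ k a ≡ continuations n L a (q ∷ occ) k
continuationsWithHead-park n L occ k a parks =
  countᵇ-cong (seqs n L) (λ t → cong (λ f → orderedFrom a t ∧ (f ≡ᵇ k)) (flawsFrom-park n occ a t parks))

continuationsWithHead-fail : ∀ n L occ k a → spot n a occ ≡ nothing →
                             continuationsWithHead n L occ (suc k) a ≡ continuations n L a occ k
continuationsWithHead-fail n L occ k a fails =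
  countᵇ-cong (seqs n L) (λ t → cong (λ f → orderedFrom a t ∧ (f ≡ᵇ suc k)) (flawsFrom-fail n occ a t fails))

continuationsWithHead-fail-0 : ∀ n L occ a → spot n a occ ≡ nothing → continuationsWithHead n L occ 0 a ≡ 0
continuationsWithHead-fail-0 n L occ a fails =
  trans (countᵇ-cong (seqs n L) (λ t → trans (cong (λ f → orderedFrom a t ∧ (f ≡ᵇ 0)) (flawsFrom-fail n occ a t fails))
                                              (∧-zeroʳ _)))
        (countᵇ-guard false (λ _ → true) (seqs n L))

-- extensions L e s k counts weakly increasing preference sequences of length L, all at least
-- some bound b, with exactly k flaws when the spaces b, …, b + e − 1 are occupied and the s
-- spaces after them are free and end the lot.  Either the first car prefers b, or every car
-- prefers at least b + 1.
extensions : ℕ → ℕ → ℕ → ℕ → ℕ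
extensions zero    e       s       zero    = 1
extensions zero    e       s       (suc k) = 0
extensions (suc L) zero    zero    k       = 0
extensions (suc L) zero    (suc s) k       = extensions L 1 s k + extensions (suc L) 0 s k
extensions (suc L) (suc e) (suc s) k       = extensions L (2 + e) s k + extensions (suc L) e (suc s) k
extensions (suc L) (suc e) zero    zero    = extensions (suc L) e zero zero
extensions (suc L) (suc e) zero    (suc k) = extensions L (suc e) zero k + extensions (suc L) e zero (suc k)

continuations≡extensions : ∀ {n occ c p} L e s k → OccupiedBlock occ (suc c) p → e + suc c ≡ suc p → s + p ≡ n →
                           continuations n L (suc c) occ k ≡ extensions L e s k
continuations≡extensions zero e s zero    _ _ _ = refl
continuations≡extensions zero e s (suc k) _ _ _ = refl
continuations≡extensions {n} {occ} {c} (suc L) zero zero k _ refl refl = continuations-beyond n L c occ k ≤-refl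
continuations≡extensions {n} {occ} {c} (suc L) zero (suc s) k block refl 1+s+c≡n = begin
  continuations n (suc L) (suc c) occ k                                               ≡⟨ continuations-step n L c occ k c<n ⟩
  continuationsWithHead n L occ k (suc c) + continuations n (suc L) (2 + c) occ k
    ≡⟨ cong (_+ continuations n (suc L) (2 + c) occ k) (continuationsWithHead-park n L occ k (suc c) parks) ⟩
  continuations n L (suc c) (suc c ∷ occ) k + continuations n (suc L) (2 + c) occ k
    ≡⟨ cong₂ _+_ (continuations≡extensions L 1 s k (occupiedBlock-park block) refl s+1+c≡n)
                 (continuations≡extensions (suc L) 0 s k (occupiedBlock-skip block) refl s+1+c≡n) ⟩
  extensions L 1 s k + extensions (suc L) 0 s k                                       ∎
  where
    open ≡-Reasoning
    s+1+c≡n = trans (+-suc s c) 1+s+c≡n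
    c<n = ≤-trans (s≤s (m≤n+m c s)) (≤-reflexive 1+s+c≡n)
    parks = spot-park n 0 s block refl 1+s+c≡n
continuations≡extensions {n} {occ} {c} {p} (suc L) (suc e) s k block 1+e+1+c≡1+p s+p≡n = begin
  continuations n (suc L) (suc c) occ k                                              ≡⟨ continuations-step n L c occ k c<n ⟩
  continuationsWithHead n L occ k (suc c) + continuations n (suc L) (2 + c) occ k    ≡⟨ cong₂ _+_ (head s k s+p≡n) rest ⟩
  extensions-head s k + extensions (suc L) e s k                                     ≡⟨ extensions-split s k ⟩
  extensions (suc L) (suc e) s k                                                     ∎
  where
    open ≡-Reasoning
    c<p : c < p
    c<p = ≤-trans (m≤n+m (suc c) e) (≤-reflexive (suc-injective 1+e+1+c≡1+p))
    c<n = ≤-trans c<p (≤-trans (m≤n+m p s) (≤-reflexive s+p≡n))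
    extensions-head : ℕ → ℕ → ℕ
    extensions-head (suc s) k       = extensions L (2 + e) s k
    extensions-head zero    zero    = 0
    extensions-head zero    (suc k) = extensions L (suc e) zero k
    extensions-split : ∀ s k → extensions-head s k + extensions (suc L) e s k ≡ extensions (suc L) (suc e) s k
    extensions-split (suc s) k       = refl
    extensions-split zero    zero    = refl
    extensions-split zero    (suc k) = refl
    head : ∀ s k → s + p ≡ n → continuationsWithHead n L occ k (suc c) ≡ extensions-head s k
    head (suc s) k s+p≡n =
      trans (continuationsWithHead-park n L occ k (suc c) (spot-park n (suc e) s block 1+e+1+c≡1+p s+p≡n))
            (continuations≡extensions L (2 + e) s k (occupiedBlock-park block) (cong suc 1+e+1+c≡1+p) (trans (+-suc s p) s+p≡n))
    head zero zero    p≡n =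
      continuationsWithHead-fail-0 n L occ (suc c) (spot-block n (suc e) 0 block 1+e+1+c≡1+p p≡n)
    head zero (suc k) p≡n =
      trans (continuationsWithHead-fail n L occ k (suc c) (spot-block n (suc e) 0 block 1+e+1+c≡1+p p≡n))
            (continuations≡extensions L (suc e) zero k block 1+e+1+c≡1+p p≡n)
    rest : continuations n (suc L) (2 + c) occ k ≡ extensions (suc L) e s k
    rest = continuations≡extensions (suc L) e s k (occupiedBlock-mono (n≤1+n _) block)
                                    (trans (+-suc e (suc c)) 1+e+1+c≡1+p) s+p≡n

op≡extensions : ∀ n m s k → s + suc m ≡ suc n → op (suc n) k (suc m) ≡ extensions n 1 s k
op≡extensions n m s k s+1+m≡1+n = begin
  op (suc n) k (suc m)                                              ≡⟨ length-filter-T? Q (seqs (suc n) (suc n)) ⟩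
  countᵇ Q (seqs (suc n) (suc n))                                   ≡⟨ countᵇ-seqs Q (suc n) n ⟩
  sumBelow (suc n) (λ i → countᵇ (λ t → Q (suc i ∷ t)) (seqs (suc n) n)) ≡⟨ sumBelow-cong (suc n) leading-guard ⟩
  sumBelow (suc n) (λ i → if i ≡ᵇ m then H (suc i) else 0)          ≡⟨ sumBelow-indicator (suc n) m (λ i → H (suc i)) m<1+n ⟩
  H (suc m)                                                         ≡⟨ continuationsWithHead-park (suc n) n [] k (suc m) first-parks ⟩
  continuations (suc n) n (suc m) (suc m ∷ []) k
    ≡⟨ continuations≡extensions n 1 s k (occupiedBlock-park (occupiedBlock-[] m)) refl s+1+m≡1+n ⟩
  extensions n 1 s k                                                ∎
  where
    open ≡-Reasoning
    Q : List ℕ → Bool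
    Q p = isOrdered p ∧ leadingIs (suc m) p ∧ (flaws (suc n) p ≡ᵇ k)
    H : ℕ → ℕ
    H = continuationsWithHead (suc n) n [] k
    leading-guard : ∀ i → countᵇ (λ t → Q (suc i ∷ t)) (seqs (suc n) n) ≡ (if i ≡ᵇ m then H (suc i) else 0)
    leading-guard i = trans (countᵇ-cong (seqs (suc n) n) leading-first) (countᵇ-guard (i ≡ᵇ m) _ (seqs (suc n) n))
      where
        leading-first : ∀ t → Q (suc i ∷ t) ≡ (i ≡ᵇ m) ∧ (orderedFrom (suc i) t ∧ (flaws (suc n) (suc i ∷ t) ≡ᵇ k))
        leading-first t = trans (cong (_∧ ((i ≡ᵇ m) ∧ (flaws (suc n) (suc i ∷ t) ≡ᵇ k))) (isOrdered-∷ (suc i) t))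
                                (∧-swap (orderedFrom (suc i) t) (i ≡ᵇ m) _)
    m<1+n : m < suc n
    m<1+n = ≤-trans (m≤n+m (suc m) s) (≤-reflexive s+1+m≡1+n)
    first-parks : spot (suc n) (suc m) [] ≡ just (suc m)
    first-parks = spot-park (suc n) 0 s (occupiedBlock-[] m) refl (trans (sym (+-suc s m)) s+1+m≡1+n)

-- Closed forms for extensions

extensions-overcrowded : ∀ L e s k → k + s < L → extensions L e s k ≡ 0
extensions-overcrowded (suc L) zero    zero    k       _ = refl
extensions-overcrowded (suc L) zero    (suc s) k       k+1+s<1+L =
  cong₂ _+_ (extensions-overcrowded L 1 s k k+s<L) (extensions-overcrowded (suc L) 0 s k (m<n⇒m<1+n k+s<L))
  where k+s<L = ≤-pred (≤-trans (≤-reflexive (cong suc (sym (+-suc k s)))) k+1+s<1+L)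
extensions-overcrowded (suc L) (suc e) (suc s) k       k+1+s<1+L =
  cong₂ _+_ (extensions-overcrowded L (2 + e) s k k+s<L) (extensions-overcrowded (suc L) e (suc s) k k+1+s<1+L)
  where k+s<L = ≤-pred (≤-trans (≤-reflexive (cong suc (sym (+-suc k s)))) k+1+s<1+L)
extensions-overcrowded (suc L) (suc e) zero    zero    k<1+L = extensions-overcrowded (suc L) e zero zero k<1+L
extensions-overcrowded (suc L) (suc e) zero    (suc k) k<1+L =
  cong₂ _+_ (extensions-overcrowded L (suc e) zero k (≤-pred k<1+L)) (extensions-overcrowded (suc L) e zero (suc k) k<1+L)

extensions-excess-flaws : ∀ L e s k → L < k → extensions L e s k ≡ 0
extensions-excess-flaws zero    e       s       (suc k) _     = refl
extensions-excess-flaws (suc L) zero    zero    k       _     = refl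
extensions-excess-flaws (suc L) zero    (suc s) k       L<k   =
  cong₂ _+_ (extensions-excess-flaws L 1 s k (<-trans (n<1+n L) L<k)) (extensions-excess-flaws (suc L) 0 s k L<k)
extensions-excess-flaws (suc L) (suc e) (suc s) k       L<k   =
  cong₂ _+_ (extensions-excess-flaws L (2 + e) s k (<-trans (n<1+n L) L<k)) (extensions-excess-flaws (suc L) e (suc s) k L<k)
extensions-excess-flaws (suc L) (suc e) zero    (suc k) L<k   =
  cong₂ _+_ (extensions-excess-flaws L (suc e) zero k (≤-pred L<k)) (extensions-excess-flaws (suc L) e zero (suc k) L<k)

extensions-not-all-flawed : ∀ L e s → extensions (suc L) e (suc s) (suc L) ≡ 0
extensions-not-all-flawed L zero    zero    = cong (_+ 0) (extensions-excess-flaws L 1 0 (suc L) ≤-refl)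
extensions-not-all-flawed L zero    (suc s) =
  cong₂ _+_ (extensions-excess-flaws L 1 (suc s) (suc L) ≤-refl) (extensions-not-all-flawed L zero s)
extensions-not-all-flawed L (suc e) s       =
  cong₂ _+_ (extensions-excess-flaws L (2 + e) s (suc L) ≤-refl) (extensions-not-all-flawed L e s)

pascal-step : ∀ d A B {M N} i {j} → A + shiftedBinom d M i ≡ binom M j → B + shiftedBinom d M (suc i) ≡ binom M (suc j) →
              N ≡ suc M → (A + B) + shiftedBinom d N (suc i) ≡ binom N (suc j)
pascal-step d A B {M} i A+x≡y B+x′≡y′ refl = begin
  (A + B) + shiftedBinom d (suc M) (suc i)                            ≡⟨ cong ((A + B) +_) (shiftedBinom-pascal d M (suc i)) ⟩
  (A + B) + (shiftedBinom d M i + shiftedBinom d M (suc i))           ≡⟨ interchange A B _ _ ⟩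
  (A + shiftedBinom d M i) + (B + shiftedBinom d M (suc i))           ≡⟨ cong₂ _+_ A+x≡y B+x′≡y′ ⟩
  _                                                                    ∎
  where open ≡-Reasoning

shiftedBinom-reflect : ∀ s k → shiftedBinom 2 (s + s + k) (suc s) ≡ binom (s + s + k) (suc (s + k))
shiftedBinom-reflect zero    k = sym (binom-above (≤-refl {suc k}))
shiftedBinom-reflect (suc s) k = begin
  binom (suc s + suc s + k) s               ≡⟨ cong (λ N → binom N s) N≡s+[2+s+k] ⟩
  binom (s + (2 + s + k)) s                 ≡⟨ binom-sym s (2 + s + k) ⟩
  binom (s + (2 + s + k)) (2 + s + k)       ≡⟨ cong (λ N → binom N (2 + s + k)) N≡s+[2+s+k] ⟨
  binom (suc s + suc s + k) (2 + s + k)     ∎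
  where
    open ≡-Reasoning
    N≡s+[2+s+k] : suc s + suc s + k ≡ s + (2 + s + k)
    N≡s+[2+s+k] = solve (s ∷ k ∷ [])

-- With s + k cars and k flaws, the s free spaces get filled exactly.
extensions-exact : ∀ s k e {N} → suc N ≡ e + s + s + k → extensions (s + k) e s k + shiftedBinom 2 N s ≡ binom N (s + k)
extensions-exact zero    zero    e       _   = refl
extensions-exact zero    (suc k) zero    eq  = sym (binom-above (≤-reflexive (cong suc (suc-injective eq))))
extensions-exact zero    (suc k) (suc e) {N} eq =
  pascal-step 2 (extensions k (suc e) zero k) (extensions (suc k) e zero (suc k)) 0
                (extensions-exact zero k (suc e) {e + k} (solve (e ∷ k ∷ [])))
                (extensions-exact zero (suc k) e {e + k} (solve (e ∷ k ∷ [])))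
                (suc-injective (trans eq (solve (e ∷ k ∷ []))))
extensions-exact (suc s) k       zero    {N} eq = begin
  (extensions (s + k) 1 s k + extensions (suc (s + k)) 0 s k) + shiftedBinom 2 N (suc s)
    ≡⟨ cong (λ x → (extensions (s + k) 1 s k + x) + shiftedBinom 2 N (suc s))
            (extensions-overcrowded (suc (s + k)) 0 s k k+s<1+s+k) ⟩
  (extensions (s + k) 1 s k + 0) + shiftedBinom 2 N (suc s)
    ≡⟨ pascal-step 2 (extensions (s + k) 1 s k) 0 s
                     (extensions-exact s k 1 {s + s + k} (solve (s ∷ k ∷ [])))
                     (shiftedBinom-reflect s k)
                     (suc-injective (trans eq (solve (s ∷ k ∷ [])))) ⟩
  binom N (suc (s + k)) ∎
  where
    open ≡-Reasoning
    k+s<1+s+k = s≤s (≤-reflexive (+-comm k s))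
extensions-exact (suc s) k       (suc e) {N} eq =
  pascal-step 2 (extensions (s + k) (2 + e) s k) (extensions (suc (s + k)) e (suc s) k) s
                (extensions-exact s k (2 + e) {suc (e + s + s + k)} (solve (e ∷ s ∷ k ∷ [])))
                (extensions-exact (suc s) k e {suc (e + s + s + k)} (solve (e ∷ s ∷ k ∷ [])))
                (suc-injective (trans eq (solve (e ∷ s ∷ k ∷ []))))

extensions-fill-ballot : ∀ j k → extensions (suc j + suc k) 0 (suc j) (suc k) ≡ ballot j (3 + k)
extensions-fill-ballot j k = +-cancelʳ-≡ (shiftedBinom 1 N j) _ _ (begin
  extensions (suc j + suc k) 0 (suc j) (suc k) + shiftedBinom 2 N (suc j)
    ≡⟨ extensions-exact (suc j) (suc k) 0 {j + (suc j + suc k)} (solve (j ∷ k ∷ [])) ⟩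
  binom N (suc j + suc k)                    ≡⟨ binom-sym j (suc j + suc k) ⟨
  binom N j                                  ≡⟨ ballot-formula j (2 + k) {j + (suc j + suc k)} (solve (j ∷ k ∷ [])) ⟨
  ballot j (3 + k) + shiftedBinom 1 N j      ∎)
  where
    open ≡-Reasoning
    N = j + (suc j + suc k)

extensions-ballot : ∀ j k e t → 0 < t ⊎ e ≡ 0 →
                    extensions (suc (j + suc k)) e (suc (j + t)) (suc k) ≡ ballot j (3 + (e + t + k))
extensions-ballot j       k (suc e) t       (inj₂ ())
extensions-ballot zero    k (suc e) zero    (inj₁ ())
extensions-ballot zero    k (suc e) (suc t) _ =
  cong₂ _+_ (extensions-not-all-flawed k (2 + e) t) (extensions-ballot zero k e (suc t) (inj₁ (s≤s z≤n)))
extensions-ballot (suc j) k (suc e) t       (inj₁ t>0) =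
  trans (cong₂ _+_ (extensions-ballot j k (2 + e) t (inj₁ t>0)) (extensions-ballot (suc j) k e t (inj₁ t>0))) (+-comm (ballot j _) _)
extensions-ballot zero    k zero    (suc t) _ =
  cong₂ _+_ (extensions-not-all-flawed k 1 t) (extensions-ballot zero k zero t (inj₂ refl))
extensions-ballot (suc j) k zero    (suc t) _ =
  trans (cong₂ _+_ (extensions-ballot j k 1 (suc t) (inj₁ (s≤s z≤n))) bound-moves) (+-comm (ballot j _) _)
  where
    bound-moves : extensions (suc (suc j + suc k)) 0 (suc j + suc t) (suc k) ≡ ballot (suc j) (3 + (t + k))
    bound-moves = subst (λ s → extensions (suc (suc j + suc k)) 0 s (suc k) ≡ ballot (suc j) (3 + (t + k)))
                        (cong suc (sym (+-suc j t))) (extensions-ballot (suc j) k zero t (inj₂ refl))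
extensions-ballot j       k zero    zero    _ =
  trans (cong (λ s → extensions (suc (j + suc k)) 0 (suc s) (suc k)) (+-identityʳ j)) (extensions-fill-ballot j k)

-- The generating functions ρ

op-no-room : ∀ m d → op (suc (suc m + d)) (suc m + d) (suc m) ≡ 0
op-no-room m d = trans (op≡extensions (suc (m + d)) m (suc d) _ (solve (m ∷ d ∷ []))) (extensions-not-all-flawed (m + d) 1 d)

op-ballot : ∀ m d j → op (j + (suc m + d + 2)) (suc m + d) (suc m) ≡ ballot j (d + (suc m + d + 4))
op-ballot m d j = begin
  op (j + (suc m + d + 2)) (suc m + d) (suc m)                    ≡⟨ cong (λ n → op n (suc m + d) (suc m)) size ⟩
  op (suc (suc (j + suc (m + d)))) (suc m + d) (suc m)
    ≡⟨ op≡extensions (suc (j + suc (m + d))) m (suc (j + suc d)) _ (solve (j ∷ m ∷ d ∷ [])) ⟩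
  extensions (suc (j + suc (m + d))) 1 (suc (j + suc d)) (suc (m + d)) ≡⟨ extensions-ballot j (m + d) 1 (suc d) (inj₁ (s≤s z≤n)) ⟩
  ballot j (3 + (1 + suc d + (m + d)))                            ≡⟨ cong (ballot j) power ⟩
  ballot j (d + (suc m + d + 4))                                  ∎
  where
    open ≡-Reasoning
    size : j + (suc m + d + 2) ≡ suc (suc (j + suc (m + d)))
    size = solve (j ∷ m ∷ d ∷ [])
    power : 3 + (1 + suc d + (m + d)) ≡ d + (suc m + d + 4)
    power = solve (m ∷ d ∷ [])

ρ≡shifted-catalan-power : ∀ m d {k} → suc m + d ≡ k → ∀ n → ρ (suc m) k n ≡ shift (k + 2) (Cser ^ˢ (d + (k + 4))) n
ρ≡shifted-catalan-power m d {k} refl = shift-intro (k + 2) (Cser ^ˢ (d + (k + 4))) vanishes coefficient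
  where
    vanishes : ∀ n → n < k + 2 → ρ (suc m) k n ≡ 0
    vanishes n n<k+2 with m≤n⇒m<n∨m≡n (≤-pred (≤-trans n<k+2 (≤-reflexive (+-comm k 2))))
    ... | inj₁ n<1+k  = cong (if_then op n k (suc m) else 0) (≤ᵇ-false n<1+k)
    ... | inj₂ refl   = trans (cong (if_then op (suc k) k (suc m) else 0) (≤ᵇ-true (≤-refl {suc k}))) (op-no-room m d)
    coefficient : ∀ j → ρ (suc m) k (j + (k + 2)) ≡ (Cser ^ˢ (d + (k + 4))) j
    coefficient j = begin
      ρ (suc m) k (j + (k + 2))          ≡⟨ cong (if_then op (j + (k + 2)) k (suc m) else 0) (≤ᵇ-true 1+k≤j+[k+2]) ⟩
      op (j + (k + 2)) k (suc m)         ≡⟨ op-ballot m d j ⟩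
      ballot j (d + (k + 4))             ≡⟨ catalan-power (d + (k + 4)) j ⟨
      (Cser ^ˢ (d + (k + 4))) j          ∎
      where
        open ≡-Reasoning
        1+k≤j+[k+2] : suc k ≤ j + (k + 2)
        1+k≤j+[k+2] = ≤-trans (≤-trans (n≤1+n (suc k)) (≤-reflexive (+-comm 2 k))) (m≤n+m (k + 2) j)

mainTheorem16 : ((k : ℕ) → 1 ≤ k → (n : ℕ) → ρ k k n ≡ shift (k + 2) (Cser ^ˢ (k + 4)) n)
                × ((m k : ℕ) → 1 ≤ m → suc m ≤ k → (n : ℕ) → ρ m k n ≡ (Cser ⊛ ρ (suc m) k) n)
mainTheorem16 = diagonal , recursion
  where
    diagonal : (k : ℕ) → 1 ≤ k → (n : ℕ) → ρ k k n ≡ shift (k + 2) (Cser ^ˢ (k + 4)) n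
    diagonal (suc m) _ = ρ≡shifted-catalan-power m 0 (+-identityʳ (suc m))
    recursion : (m k : ℕ) → 1 ≤ m → suc m ≤ k → (n : ℕ) → ρ m k n ≡ (Cser ⊛ ρ (suc m) k) n
    recursion (suc m) k _ 2+m≤k n = begin
      ρ (suc m) k n                                      ≡⟨ ρ≡shifted-catalan-power m (suc d) (trans (+-suc (suc m) d) 2+m+d≡k) n ⟩
      shift (k + 2) (Cser ⊛ (Cser ^ˢ (d + (k + 4)))) n   ≡⟨ ⊛-shift Cser (Cser ^ˢ (d + (k + 4))) (k + 2) n ⟨
      (Cser ⊛ shift (k + 2) (Cser ^ˢ (d + (k + 4)))) n
        ≡⟨ sumTo-cong n (λ i _ → cong (Cser i *_) (ρ≡shifted-catalan-power (suc m) d 2+m+d≡k (n ∸ i))) ⟨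
      (Cser ⊛ ρ (suc (suc m)) k) n                       ∎
      where
        open ≡-Reasoning
        d = k ∸ suc (suc m)
        2+m+d≡k : suc (suc m) + d ≡ k
        2+m+d≡k = m+[n∸m]≡n 2+m≤k
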